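{- Let $(g(x),f(x))$ be a Riordan array and let $\phi(x)=\mathrm{Rev}\left(\frac{x^2}{f(x)}\right)$. Then the vertical half $V$ of $(g(x),f(x))$ factors as $$V=(g(\phi(x)),x)\cdot\left(\frac{x\phi'(x)}{\phi(x)},\phi(x)\right),$$ where the factor $\left(\frac{x\phi'(x)}{\phi(x)},\phi(x)\right)$ is an element of the hitting-time subgroup of the Riordan group.
   Context: All power series are formal power series with complex coefficients. A Riordan array is a pair $(g(x),f(x))$ of power series with $g(0)\neq 0$, $f(0)=0$, $f'(0)\neq 0$; it is identified with the infinite lower triangular matrix $(t_{n,k})_{n,k\ge 0}$, $t_{n,k}=[x^n]g(x)f(x)^k$. The product is $(g,f)\cdot(u,v)=(g(x)u(f(x)),v(f(x)))$, which corresponds to matrix multiplication; these pairs form the Riordan group. $\mathrm{Rev}(h)$ denotes the compositional inverse of a power series $h$ with $h(0)=0$, $h'(0)\ne0$. The vertical half of a Riordan array with matrix $(t_{n,k})$ is the matrix $V$ whose $(n,k)$ entry is $t_{2n-k,n}$ (with $t_{i,j}=0$ when $j>i$). The hitting-time subgroup consists of the Riordan arrays of the form $\left(\frac{xf'(x)}{f(x)},f(x)\right)$. -}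

module Defs where

open import Level using (_⊔_) renaming (suc to lsuc)
open import Algebra.Bundles using (CommutativeRing)
open import Data.Nat as ℕ using (ℕ; zero; suc; _∸_; _≤?_)
open import Data.Vec using (Vec; []; _∷_; head; zipWith; map; foldr)
open import Data.Vec as V using ()
open import Data.Product using (Σ; _×_; proj₁)
open import Relation.Nullary using (¬_; yes; no)

module Series {c ℓ} (R : CommutativeRing c ℓ) where
  open CommutativeRing R

  FPS : Set c
  FPS = ℕ → Carrier

  _≋_ : FPS → FPS → Set ℓ
  a ≋ b = ∀ n → a n ≈ b n

  _·ℕ_ : ℕ → Carrier → Carrier
  zero  ·ℕ r = 0#
  suc n ·ℕ r = r + (n ·ℕ r)

  Σ≤ : ℕ → (ℕ → Carrier) → Carrier
  Σ≤ zero    h = h 0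
  Σ≤ (suc n) h = Σ≤ n h + h (suc n)

  𝟙 : FPS
  𝟙 zero    = 1#
  𝟙 (suc n) = 0#

  X : FPS
  X zero          = 0#
  X (suc zero)    = 1#
  X (suc (suc n)) = 0#

  _⋆_ : FPS → FPS → FPS
  (a ⋆ b) n = Σ≤ n (λ i → a i * b (n ∸ i))

  pow : FPS → ℕ → FPS
  pow a zero    = 𝟙
  pow a (suc k) = a ⋆ pow a k

  -- composition g(f(x)); meaningful when f 0 ≈ 0
  comp : FPS → FPS → FPS
  comp g f n = Σ≤ n (λ k → g k * pow f k n)

  deriv : FPS → FPS
  deriv a n = suc n ·ℕ a (suc n)

  -- a(x)/x ; meaningful when a 0 ≈ 0
  divX : FPS → FPS
  divX a n = a (suc n)

  -- multiplicative inverse of a series a, given an inverse c of a 0: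
  --   u 0 = c,  u (n+1) = - c * Σ_{i=1}^{n+1} a i * u (n+1-i).
  -- invUpTo a c n = (u n ∷ u (n-1) ∷ … ∷ u 0)
  invUpTo : FPS → Carrier → (n : ℕ) → Vec Carrier (suc n)
  invUpTo a c zero    = c ∷ []
  invUpTo a c (suc n) =
    let prev = invUpTo a c n in
    (- (c * foldr _ _+_ 0# (zipWith _*_ (V.map (λ i → a (suc (Data.Fin.toℕ i))) (V.allFin (suc n))) prev)))
    ∷ prev
    where import Data.Fin

  invS : FPS → Carrier → FPS
  invS a c n = head (invUpTo a c n)

  IsRev : FPS → FPS → Set ℓ
  IsRev h ψ = (ψ 0 ≈ 0#) × (comp h ψ ≋ X)

  Mat : Set c
  Mat = ℕ → ℕ → Carrier

  _≋ₘ_ : Mat → Mat → Set ℓ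
  M ≋ₘ N = ∀ n k → M n k ≈ N n k

  _×ₘ_ : Mat → Mat → Mat
  (M ×ₘ N) n k = Σ≤ n (λ j → M n j * N j k)

  riordan : FPS → FPS → Mat
  riordan g f n k = (g ⋆ pow f k) n

  verticalHalf : Mat → Mat
  verticalHalf t n k with k ℕ.≤? (n ℕ.+ n)
  ... | yes _ = t ((n ℕ.+ n) ∸ k) n
  ... | no  _ = 0#

-- Fields of characteristic zero (stand-in for ℂ, which is not available).

record Field c ℓ : Set (lsuc (c ⊔ ℓ)) where
  field
    commRing : CommutativeRing c ℓ
  open CommutativeRing commRing
  open Series commRing using (_·ℕ_)
  field
    0≉1      : ¬ (0# ≈ 1#)
    inv      : ∀ x → ¬ (x ≈ 0#) → Σ Carrier (λ y → x * y ≈ 1#)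
    charZero : ∀ n → ¬ (suc n ·ℕ 1# ≈ 0#)

module FieldOps {c ℓ} (F : Field c ℓ) where
  open Field F public
  open CommutativeRing commRing public
  open Series commRing public

  -- x² / f(x) = x · (f(x)/x)⁻¹, for f with f 0 ≈ 0 and f 1 ≉ 0
  x²/ : (f : FPS) → ¬ (f 1 ≈ 0#) → FPS
  x²/ f f1 = X ⋆ invS (divX f) (proj₁ (inv (f 1) f1))

  -- x φ'(x)/φ(x) = φ'(x) · (φ(x)/x)⁻¹, for φ with φ 0 ≈ 0 and φ 1 ≉ 0
  xφ'/φ : (φ : FPS) → ¬ (φ 1 ≈ 0#) → FPS
  xφ'/φ φ φ1 = deriv φ ⋆ invS (divX φ) (proj₁ (inv (φ 1) φ1))

-- Write f = xψ, w = 1/ψ (so x²/f = h = xw) and u = xφ′/φ. Then t(2n−k,n) = [x^(n−k)] g ψⁿ, while the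
-- (n,k) entry of the product is Σᵢ gᵢ [xⁿ] u φ^(k+i), so the theorem reduces to the Lagrange inversion
-- formula [xⁿ] u φᵐ = [x^(n−m)] ψⁿ. Both sides, as matrices indexed by (n,m), are left inverses of the
-- lower triangular Riordan array (xh′/h, h), whose diagonal is invertible. For (u, φ) this is the
-- Riordan product (u, φ)(xh′/h, h) = (u · (xh′/h)∘φ, h∘φ) = (1, x), by the chain rule; for the powers of
-- ψ it reduces to [x^d] (xh′/h) ψ^d = δ(d,0), a residue computation.

module Submission where

open import Defs
open import Algebra.Bundles using (CommutativeRing)
open import Data.Nat as ℕ using (ℕ; zero; suc; _∸_; _≤_; _<_; z≤n; s≤s)
import Data.Nat.Properties as ℕ
open import Relation.Binary.PropositionalEquality as P using (_≡_)
open import Data.Product using (Σ; _,_; proj₁; proj₂)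
open import Data.Sum using (inj₁; inj₂)
open import Data.Empty using (⊥-elim)
open import Relation.Nullary using (¬_; Dec; yes; no)
open import Function using (_∘_)
import Algebra.Properties.CommutativeSemigroup as CommSemigroupProperties
import Algebra.Properties.Group as GroupProperties
import Algebra.Properties.AbelianGroup as AbelianGroupProperties
import Algebra.Properties.Ring as RingProperties
import Algebra.Solver.Ring.NaturalCoefficients.Default as NatCoeffSolver
import Data.Fin as Fin
import Data.Vec as Vec
import Data.Vec.Properties as Vec
import Relation.Binary.Reasoning.Setoid as SetoidReasoning

module Sums {c ℓ} (R : CommutativeRing c ℓ) where
  open CommutativeRing R hiding (zero)
  open Series R
  open SetoidReasoning setoid
  open CommSemigroupProperties +-commutativeSemigroup using (interchange)
  open GroupProperties +-group using (x∙y⁻¹≈ε⇒x≈y)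
  open AbelianGroupProperties +-abelianGroup using (⁻¹-∙-comm)
  open RingProperties ring using (-‿distribˡ-*)

  Σ≤-cong : ∀ n {h h′ : ℕ → Carrier} → (∀ i → h i ≈ h′ i) → Σ≤ n h ≈ Σ≤ n h′
  Σ≤-cong zero    h≈h′ = h≈h′ 0
  Σ≤-cong (suc n) h≈h′ = +-cong (Σ≤-cong n h≈h′) (h≈h′ (suc n))

  Σ≤-cong-≤ : ∀ n {h h′ : ℕ → Carrier} → (∀ i → i ≤ n → h i ≈ h′ i) → Σ≤ n h ≈ Σ≤ n h′
  Σ≤-cong-≤ zero    h≈h′ = h≈h′ 0 z≤n
  Σ≤-cong-≤ (suc n) h≈h′ =
    +-cong (Σ≤-cong-≤ n (λ i i≤n → h≈h′ i (ℕ.m≤n⇒m≤1+n i≤n))) (h≈h′ (suc n) ℕ.≤-refl)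

  Σ≤-zero : ∀ n {h : ℕ → Carrier} → (∀ i → i ≤ n → h i ≈ 0#) → Σ≤ n h ≈ 0#
  Σ≤-zero zero    h≈0 = h≈0 0 z≤n
  Σ≤-zero (suc n) h≈0 =
    trans (+-cong (Σ≤-zero n (λ i i≤n → h≈0 i (ℕ.m≤n⇒m≤1+n i≤n))) (h≈0 (suc n) ℕ.≤-refl))
          (+-identityˡ 0#)

  Σ≤-distrib-+ : ∀ n (h k : ℕ → Carrier) → Σ≤ n (λ i → h i + k i) ≈ Σ≤ n h + Σ≤ n k
  Σ≤-distrib-+ zero    h k = refl
  Σ≤-distrib-+ (suc n) h k = trans (+-cong (Σ≤-distrib-+ n h k) refl) (interchange _ _ _ _)

  *-distribˡ-Σ≤ : ∀ n a (h : ℕ → Carrier) → a * Σ≤ n h ≈ Σ≤ n (λ i → a * h i)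
  *-distribˡ-Σ≤ zero    a h = refl
  *-distribˡ-Σ≤ (suc n) a h = trans (distribˡ a _ _) (+-cong (*-distribˡ-Σ≤ n a h) refl)

  *-distribʳ-Σ≤ : ∀ n a (h : ℕ → Carrier) → Σ≤ n h * a ≈ Σ≤ n (λ i → h i * a)
  *-distribʳ-Σ≤ n a h =
    trans (*-comm _ _) (trans (*-distribˡ-Σ≤ n a h) (Σ≤-cong n (λ i → *-comm _ _)))

  Σ≤-suc : ∀ n (h : ℕ → Carrier) → Σ≤ (suc n) h ≈ h 0 + Σ≤ n (λ i → h (suc i))
  Σ≤-suc zero    h = refl
  Σ≤-suc (suc n) h = trans (+-cong (Σ≤-suc n h) refl) (+-assoc _ _ _)

  Σ≤-reverse : ∀ n (h : ℕ → Carrier) → Σ≤ n h ≈ Σ≤ n (λ i → h (n ∸ i))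
  Σ≤-reverse zero    h = refl
  Σ≤-reverse (suc n) h = begin
    Σ≤ n h + h (suc n)                     ≈⟨ +-comm _ _ ⟩
    h (suc n) + Σ≤ n h                     ≈⟨ +-cong refl (Σ≤-reverse n h) ⟩
    h (suc n) + Σ≤ n (λ i → h (n ∸ i))     ≈⟨ Σ≤-suc n _ ⟨
    Σ≤ (suc n) (λ i → h (suc n ∸ i))       ∎

  Σ≤-extend : ∀ {n N} (h : ℕ → Carrier) → n ≤ N → (∀ i → n < i → i ≤ N → h i ≈ 0#) →
              Σ≤ N h ≈ Σ≤ n h
  Σ≤-extend {n} {N} h n≤N h≈0 =
    trans (reflexive (P.cong (λ m → Σ≤ m h) (P.sym (ℕ.m∸n+n≡m n≤N))))
          (extend-by (N ∸ n) (λ i n<i i≤ → h≈0 i n<i (P.subst (i ≤_) (ℕ.m∸n+n≡m n≤N) i≤)))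
    where
    extend-by : ∀ d → (∀ i → n < i → i ≤ d ℕ.+ n → h i ≈ 0#) → Σ≤ (d ℕ.+ n) h ≈ Σ≤ n h
    extend-by zero    _   = refl
    extend-by (suc d) h≈0 =
      trans (+-cong (extend-by d (λ i n<i i≤ → h≈0 i n<i (ℕ.m≤n⇒m≤1+n i≤)))
                    (h≈0 (suc (d ℕ.+ n)) (s≤s (ℕ.m≤n+m n d)) ℕ.≤-refl))
            (+-identityʳ _)

  Σ≤-comm : ∀ n m (F : ℕ → ℕ → Carrier) →
            Σ≤ n (λ i → Σ≤ m (F i)) ≈ Σ≤ m (λ j → Σ≤ n (λ i → F i j))
  Σ≤-comm zero    m F = refl
  Σ≤-comm (suc n) m F = begin
    Σ≤ n (λ i → Σ≤ m (F i)) + Σ≤ m (F (suc n))          ≈⟨ +-cong (Σ≤-comm n m F) refl ⟩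
    Σ≤ m (λ j → Σ≤ n (λ i → F i j)) + Σ≤ m (F (suc n))  ≈⟨ Σ≤-distrib-+ m _ _ ⟨
    Σ≤ m (λ j → Σ≤ n (λ i → F i j) + F (suc n) j)       ∎

  Σ≤-triangle : ∀ n (F : ℕ → ℕ → Carrier) →
                Σ≤ n (λ k → Σ≤ k (F k)) ≈ Σ≤ n (λ j → Σ≤ (n ∸ j) (λ i → F (j ℕ.+ i) j))
  Σ≤-triangle zero    F = refl
  Σ≤-triangle (suc n) F = begin
    Σ≤ n (λ k → Σ≤ k (F k)) + Σ≤ (suc n) (F (suc n))
      ≈⟨ +-cong (Σ≤-triangle n F) refl ⟩
    Σ≤ n G + (Σ≤ n (F (suc n)) + F (suc n) (suc n))
      ≈⟨ +-assoc _ _ _ ⟨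
    (Σ≤ n G + Σ≤ n (F (suc n))) + F (suc n) (suc n)
      ≈⟨ +-cong (Σ≤-distrib-+ n _ _) refl ⟨
    Σ≤ n (λ j → G j + F (suc n) j) + F (suc n) (suc n)
      ≈⟨ +-cong (Σ≤-cong-≤ n column) (reflexive (P.cong₂ F (P.sym (ℕ.+-identityʳ (suc n))) P.refl)) ⟩
    Σ≤ n (λ j → Σ≤ (suc n ∸ j) (λ i → F (j ℕ.+ i) j)) + F (suc n ℕ.+ 0) (suc n)
      ≈⟨ +-cong refl (reflexive (P.cong (λ m → Σ≤ m (λ i → F (suc n ℕ.+ i) (suc n))) (P.sym (ℕ.n∸n≡0 n)))) ⟩
    Σ≤ n (λ j → Σ≤ (suc n ∸ j) (λ i → F (j ℕ.+ i) j)) + Σ≤ (n ∸ n) (λ i → F (suc n ℕ.+ i) (suc n)) ∎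
    where
    G : ℕ → Carrier
    G j = Σ≤ (n ∸ j) (λ i → F (j ℕ.+ i) j)
    column : ∀ j → j ≤ n → G j + F (suc n) j ≈ Σ≤ (suc n ∸ j) (λ i → F (j ℕ.+ i) j)
    column j j≤n = begin
      G j + F (suc n) j
        ≈⟨ +-cong refl (reflexive (P.cong₂ F (P.trans (P.cong suc (P.sym (ℕ.m+[n∸m]≡n j≤n)))
                                                        (P.sym (ℕ.+-suc j (n ∸ j)))) P.refl)) ⟩
      Σ≤ (suc (n ∸ j)) (λ i → F (j ℕ.+ i) j)
        ≈⟨ reflexive (P.cong (λ m → Σ≤ m (λ i → F (j ℕ.+ i) j)) (P.sym (ℕ.+-∸-assoc 1 j≤n))) ⟩
      Σ≤ (suc n ∸ j) (λ i → F (j ℕ.+ i) j) ∎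

  Σ≤-single : ∀ n i₀ (h : ℕ → Carrier) → i₀ ≤ n → (∀ i → i ≤ n → ¬ i ≡ i₀ → h i ≈ 0#) →
              Σ≤ n h ≈ h i₀
  Σ≤-single zero    .zero h z≤n _ = refl
  Σ≤-single (suc n) i₀ h i₀≤ h≈0 with ℕ.m≤n⇒m<n∨m≡n i₀≤
  ... | inj₁ (s≤s i₀≤n) =
    trans (+-cong (Σ≤-single n i₀ h i₀≤n (λ i i≤n → h≈0 i (ℕ.m≤n⇒m≤1+n i≤n)))
                  (h≈0 (suc n) ℕ.≤-refl (λ e → ℕ.<-irrefl (P.sym e) (s≤s i₀≤n))))
          (+-identityʳ _)
  ... | inj₂ P.refl =
    trans (+-cong (Σ≤-zero n (λ i i≤n → h≈0 i (ℕ.m≤n⇒m≤1+n i≤n) (λ e → ℕ.<-irrefl e (s≤s i≤n)))) refl)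
          (+-identityˡ _)

  -‿distrib-Σ≤ : ∀ n (h : ℕ → Carrier) → - Σ≤ n h ≈ Σ≤ n (λ i → - h i)
  -‿distrib-Σ≤ zero    h = refl
  -‿distrib-Σ≤ (suc n) h = trans (sym (⁻¹-∙-comm _ _)) (+-cong (-‿distrib-Σ≤ n h) refl)

  module _ (n : ℕ) (B : ℕ → ℕ → Carrier)
           (B-diagonal-invertible : ∀ j → Σ Carrier λ y → B j j * y ≈ 1#)
           (B-lower-triangular : ∀ j k → j < k → B j k ≈ 0#) where

    triangular-kernel : (D : ℕ → Carrier) → (∀ k → Σ≤ n (λ j → D j * B j k) ≈ 0#) →
                        ∀ k → k ≤ n → D k ≈ 0#
    triangular-kernel D DB≈0 k k≤n = from-top n k k≤n (ℕ.m≤n+m n k)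
      where
      pivot : ∀ k → k ≤ n → (∀ j → j ≤ n → k < j → D j ≈ 0#) → D k ≈ 0#
      pivot k k≤n D>k≈0 = begin
        D k                                 ≈⟨ *-identityʳ _ ⟨
        D k * 1#                            ≈⟨ *-cong refl (proj₂ (B-diagonal-invertible k)) ⟨
        D k * (B k k * y)                   ≈⟨ *-assoc _ _ _ ⟨
        D k * B k k * y                     ≈⟨ *-cong (Σ≤-single n k _ k≤n off-pivot) refl ⟨
        Σ≤ n (λ j → D j * B j k) * y        ≈⟨ *-cong (DB≈0 k) refl ⟩
        0# * y                              ≈⟨ zeroˡ y ⟩
        0#                                  ∎
        where
        y : Carrier
        y = proj₁ (B-diagonal-invertible k)
        off-pivot : ∀ j → j ≤ n → ¬ j ≡ k → D j * B j k ≈ 0#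
        off-pivot j j≤n j≢k with j ℕ.<? k
        ... | yes j<k = trans (*-cong refl (B-lower-triangular j k j<k)) (zeroʳ _)
        ... | no  j≮k = trans (*-cong (D>k≈0 j j≤n (ℕ.≤∧≢⇒< (ℕ.≮⇒≥ j≮k) (j≢k ∘ P.sym))) refl) (zeroˡ _)
      from-top : ∀ t k → k ≤ n → n ≤ k ℕ.+ t → D k ≈ 0#
      from-top zero    k k≤n n≤k+0 = pivot k k≤n λ j j≤n k<j →
        ⊥-elim (ℕ.<-irrefl P.refl (ℕ.<-≤-trans k<j (ℕ.≤-trans j≤n (P.subst (n ≤_) (ℕ.+-identityʳ k) n≤k+0))))
      from-top (suc t) k k≤n n≤k+1+t = pivot k k≤n λ j j≤n k<j →
        from-top t j j≤n (ℕ.≤-trans n≤k+1+t (P.subst (_≤ j ℕ.+ t) (P.sym (ℕ.+-suc k t)) (ℕ.+-monoˡ-≤ t k<j)))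

    triangular-cancel : (A A′ : ℕ → Carrier) →
                        (∀ k → Σ≤ n (λ j → A j * B j k) ≈ Σ≤ n (λ j → A′ j * B j k)) →
                        ∀ k → k ≤ n → A k ≈ A′ k
    triangular-cancel A A′ AB≈A′B k k≤n =
      x∙y⁻¹≈ε⇒x≈y _ _ (triangular-kernel (λ j → A j - A′ j) difference k k≤n)
      where
      difference : ∀ k → Σ≤ n (λ j → (A j - A′ j) * B j k) ≈ 0#
      difference k = begin
        Σ≤ n (λ j → (A j - A′ j) * B j k)
          ≈⟨ Σ≤-cong n (λ j → trans (distribʳ _ _ _) (+-cong refl (sym (-‿distribˡ-* _ _)))) ⟩
        Σ≤ n (λ j → A j * B j k + - (A′ j * B j k))
          ≈⟨ Σ≤-distrib-+ n _ _ ⟩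
        Σ≤ n (λ j → A j * B j k) + Σ≤ n (λ j → - (A′ j * B j k))
          ≈⟨ +-cong (AB≈A′B k) (sym (-‿distrib-Σ≤ n _)) ⟩
        Σ≤ n (λ j → A′ j * B j k) - Σ≤ n (λ j → A′ j * B j k)
          ≈⟨ -‿inverseʳ _ ⟩
        0# ∎

module SeriesRing {c ℓ} (R : CommutativeRing c ℓ) where
  open CommutativeRing R hiding (zero)
  open Series R
  open Sums R

  infixl 6 _+ₛ_

  _+ₛ_ : FPS → FPS → FPS
  (a +ₛ b) n = a n + b n

  -ₛ_ : FPS → FPS
  (-ₛ a) n = - a n

  𝟘 : FPS
  𝟘 n = 0#

  ≋-refl : ∀ {a} → a ≋ a
  ≋-refl n = refl

  ≋-sym : ∀ {a b} → a ≋ b → b ≋ a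
  ≋-sym a≋b n = sym (a≋b n)

  ≋-trans : ∀ {a b d} → a ≋ b → b ≋ d → a ≋ d
  ≋-trans a≋b b≋d n = trans (a≋b n) (b≋d n)

  +ₛ-cong : ∀ {a a′ b b′} → a ≋ a′ → b ≋ b′ → (a +ₛ b) ≋ (a′ +ₛ b′)
  +ₛ-cong a≋a′ b≋b′ n = +-cong (a≋a′ n) (b≋b′ n)

  ⋆-cong : ∀ {a a′ b b′} → a ≋ a′ → b ≋ b′ → (a ⋆ b) ≋ (a′ ⋆ b′)
  ⋆-cong a≋a′ b≋b′ n = Σ≤-cong n (λ i → *-cong (a≋a′ i) (b≋b′ (n ∸ i)))

  ⋆-congˡ : ∀ a {b b′} → b ≋ b′ → (a ⋆ b) ≋ (a ⋆ b′)
  ⋆-congˡ a = ⋆-cong {a} ≋-refl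

  ⋆-congʳ : ∀ b {a a′} → a ≋ a′ → (a ⋆ b) ≋ (a′ ⋆ b)
  ⋆-congʳ b a≋a′ = ⋆-cong a≋a′ (≋-refl {b})

  ⋆-comm : ∀ a b → (a ⋆ b) ≋ (b ⋆ a)
  ⋆-comm a b n = begin
    Σ≤ n (λ i → a i * b (n ∸ i))              ≈⟨ Σ≤-reverse n _ ⟩
    Σ≤ n (λ i → a (n ∸ i) * b (n ∸ (n ∸ i)))
      ≈⟨ Σ≤-cong-≤ n (λ i i≤n → trans (*-comm _ _) (*-cong (reflexive (P.cong b (ℕ.m∸[m∸n]≡n i≤n))) refl)) ⟩
    Σ≤ n (λ i → b i * a (n ∸ i))              ∎
    where open SetoidReasoning setoid

  ⋆-assoc : ∀ a b d → ((a ⋆ b) ⋆ d) ≋ (a ⋆ (b ⋆ d))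
  ⋆-assoc a b d n = begin
    Σ≤ n (λ k → Σ≤ k (λ j → a j * b (k ∸ j)) * d (n ∸ k))
      ≈⟨ Σ≤-cong n (λ k → *-distribʳ-Σ≤ k _ _) ⟩
    Σ≤ n (λ k → Σ≤ k (λ j → a j * b (k ∸ j) * d (n ∸ k)))
      ≈⟨ Σ≤-triangle n _ ⟩
    Σ≤ n (λ j → Σ≤ (n ∸ j) (λ i → a j * b (j ℕ.+ i ∸ j) * d (n ∸ (j ℕ.+ i))))
      ≈⟨ Σ≤-cong n (λ j → Σ≤-cong (n ∸ j) (λ i → trans (*-assoc _ _ _)
           (*-cong refl (*-cong (reflexive (P.cong b (ℕ.m+n∸m≡n j i)))
                                (reflexive (P.cong d (P.sym (ℕ.∸-+-assoc n j i)))))))) ⟩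
    Σ≤ n (λ j → Σ≤ (n ∸ j) (λ i → a j * (b i * d (n ∸ j ∸ i))))
      ≈⟨ Σ≤-cong n (λ j → *-distribˡ-Σ≤ (n ∸ j) _ _) ⟨
    Σ≤ n (λ j → a j * Σ≤ (n ∸ j) (λ i → b i * d (n ∸ j ∸ i))) ∎
    where open SetoidReasoning setoid

  ⋆-distribˡ : ∀ a b d → (a ⋆ (b +ₛ d)) ≋ ((a ⋆ b) +ₛ (a ⋆ d))
  ⋆-distribˡ a b d n = trans (Σ≤-cong n (λ i → distribˡ _ _ _)) (Σ≤-distrib-+ n _ _)

  ⋆-distribʳ : ∀ a b d → ((b +ₛ d) ⋆ a) ≋ ((b ⋆ a) +ₛ (d ⋆ a))
  ⋆-distribʳ a b d n = trans (Σ≤-cong n (λ i → distribʳ _ _ _)) (Σ≤-distrib-+ n _ _)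

  ⋆-identityˡ : ∀ a → (𝟙 ⋆ a) ≋ a
  ⋆-identityˡ a zero    = *-identityˡ _
  ⋆-identityˡ a (suc n) = begin
    Σ≤ (suc n) (λ i → 𝟙 i * a (suc n ∸ i))         ≈⟨ Σ≤-suc n _ ⟩
    1# * a (suc n) + Σ≤ n (λ i → 0# * a (n ∸ i))   ≈⟨ +-cong (*-identityˡ _) (Σ≤-zero n (λ i _ → zeroˡ _)) ⟩
    a (suc n) + 0#                                 ≈⟨ +-identityʳ _ ⟩
    a (suc n)                                      ∎
    where open SetoidReasoning setoid

  ⋆-identityʳ : ∀ a → (a ⋆ 𝟙) ≋ a
  ⋆-identityʳ a n = trans (⋆-comm a 𝟙 n) (⋆-identityˡ a n)

  ⋆-zeroˡ : ∀ a → (𝟘 ⋆ a) ≋ 𝟘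
  ⋆-zeroˡ a n = Σ≤-zero n (λ i _ → zeroˡ _)

  FPS-commutativeRing : CommutativeRing c ℓ
  FPS-commutativeRing = record
    { Carrier = FPS ; _≈_ = _≋_ ; _+_ = _+ₛ_ ; _*_ = _⋆_ ; -_ = -ₛ_ ; 0# = 𝟘 ; 1# = 𝟙
    ; isCommutativeRing = record
      { isRing = record
        { +-isAbelianGroup = record
          { isGroup = record
            { isMonoid = record
              { isSemigroup = record
                { isMagma = record
                  { isEquivalence = record { refl = ≋-refl ; sym = ≋-sym ; trans = ≋-trans }
                  ; ∙-cong = +ₛ-cong }
                ; assoc = λ a b d n → +-assoc (a n) (b n) (d n) }
              ; identity = (λ a n → +-identityˡ (a n)) , (λ a n → +-identityʳ (a n)) }
            ; inverse = (λ a n → -‿inverseˡ (a n)) , (λ a n → -‿inverseʳ (a n))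
            ; ⁻¹-cong = λ a≋b n → -‿cong (a≋b n) }
          ; comm = λ a b n → +-comm (a n) (b n) }
        ; *-cong = ⋆-cong
        ; *-assoc = ⋆-assoc
        ; *-identity = ⋆-identityˡ , ⋆-identityʳ
        ; distrib = ⋆-distribˡ , ⋆-distribʳ }
      ; *-comm = ⋆-comm } }

  module ≋-Reasoning = SetoidReasoning (CommutativeRing.setoid FPS-commutativeRing)
  open CommSemigroupProperties (CommutativeRing.*-commutativeSemigroup FPS-commutativeRing)
    public using () renaming (interchange to ⋆-interchange; x∙yz≈y∙xz to ⋆-lcomm)

  inverse-unique : ∀ {a b d} → (a ⋆ b) ≋ 𝟙 → (d ⋆ b) ≋ 𝟙 → a ≋ d
  inverse-unique {a} {b} {d} ab≋1 db≋1 = begin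
    a              ≈⟨ ⋆-identityʳ a ⟨
    a ⋆ 𝟙          ≈⟨ ⋆-cong ≋-refl db≋1 ⟨
    a ⋆ (d ⋆ b)    ≈⟨ ⋆-lcomm a d b ⟩
    d ⋆ (a ⋆ b)    ≈⟨ ⋆-cong ≋-refl ab≋1 ⟩
    d ⋆ 𝟙          ≈⟨ ⋆-identityʳ d ⟩
    d              ∎
    where open ≋-Reasoning

  ord≥ : FPS → ℕ → Set ℓ
  ord≥ a p = ∀ i → i < p → a i ≈ 0#

  ord≥-0 : ∀ a → ord≥ a 0
  ord≥-0 a i ()

  ⋆-ord≥ : ∀ {a b p q} → ord≥ a p → ord≥ b q → ord≥ (a ⋆ b) (p ℕ.+ q)
  ⋆-ord≥ {a} {b} {p} {q} a≥p b≥q n n<p+q = Σ≤-zero n term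
    where
    term : ∀ i → i ≤ n → a i * b (n ∸ i) ≈ 0#
    term i i≤n with i ℕ.<? p
    ... | yes i<p = trans (*-cong (a≥p i i<p) refl) (zeroˡ _)
    ... | no  i≮p = trans (*-cong refl (b≥q (n ∸ i) n∸i<q)) (zeroʳ _)
      where
      p≤i : p ≤ i
      p≤i = ℕ.≮⇒≥ i≮p
      n∸i<q : n ∸ i < q
      n∸i<q = ℕ.≤-<-trans (ℕ.∸-monoʳ-≤ n p≤i)
                (P.subst (n ∸ p <_) (ℕ.m+n∸m≡n p q) (ℕ.∸-monoˡ-< n<p+q (ℕ.≤-trans p≤i i≤n)))

  pow-ord≥ : ∀ {a} → ord≥ a 1 → ∀ k → ord≥ (pow a k) k
  pow-ord≥ a≥1 zero    = ord≥-0 _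
  pow-ord≥ a≥1 (suc k) = ⋆-ord≥ a≥1 (pow-ord≥ a≥1 k)

  X-ord≥1 : ord≥ X 1
  X-ord≥1 zero    _ = refl
  X-ord≥1 (suc i) (s≤s ())

  Σ≤-X-suc : ∀ m (H : ℕ → Carrier) → Σ≤ m (λ k → X (suc k) * H k) ≈ H 0
  Σ≤-X-suc zero    H = *-identityˡ _
  Σ≤-X-suc (suc m) H =
    trans (Σ≤-suc m _) (trans (+-cong (*-identityˡ _) (Σ≤-zero m (λ i _ → zeroˡ _))) (+-identityʳ _))

  X⋆-zero : ∀ a → (X ⋆ a) 0 ≈ 0#
  X⋆-zero a = zeroˡ _

  X⋆-suc : ∀ a n → (X ⋆ a) (suc n) ≈ a n
  X⋆-suc a n =
    trans (Σ≤-suc n _) (trans (+-cong (zeroˡ _) (Σ≤-X-suc n (λ i → a (n ∸ i)))) (+-identityˡ _))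

  X⋆-cancel : ∀ {a b} → (X ⋆ a) ≋ (X ⋆ b) → a ≋ b
  X⋆-cancel {a} {b} Xa≋Xb n = trans (sym (X⋆-suc a n)) (trans (Xa≋Xb (suc n)) (X⋆-suc b n))

  X⋆-divX : ∀ {a} → a 0 ≈ 0# → a ≋ (X ⋆ divX a)
  X⋆-divX {a} a₀≈0 zero    = trans a₀≈0 (sym (X⋆-zero (divX a)))
  X⋆-divX {a} a₀≈0 (suc n) = sym (X⋆-suc (divX a) n)

  pow-X⋆-+ : ∀ k a m → (pow X k ⋆ a) (k ℕ.+ m) ≈ a m
  pow-X⋆-+ zero    a m = ⋆-identityˡ a m
  pow-X⋆-+ (suc k) a m = trans (⋆-assoc X (pow X k) a (suc (k ℕ.+ m)))
                               (trans (X⋆-suc (pow X k ⋆ a) (k ℕ.+ m)) (pow-X⋆-+ k a m))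

  pow-X⋆-∸ : ∀ k a n → k ≤ n → (pow X k ⋆ a) n ≈ a (n ∸ k)
  pow-X⋆-∸ k a n k≤n =
    trans (reflexive (P.cong (pow X k ⋆ a) (P.sym (ℕ.m+[n∸m]≡n k≤n)))) (pow-X⋆-+ k a (n ∸ k))

  pow-X⋆-< : ∀ k a n → n < k → (pow X k ⋆ a) n ≈ 0#
  pow-X⋆-< k a n n<k =
    ⋆-ord≥ (pow-ord≥ X-ord≥1 k) (ord≥-0 a) n (P.subst (n <_) (P.sym (ℕ.+-identityʳ k)) n<k)

  pow-cong : ∀ {a b} → a ≋ b → ∀ k → pow a k ≋ pow b k
  pow-cong a≋b zero    = ≋-refl
  pow-cong a≋b (suc k) = ⋆-cong a≋b (pow-cong a≋b k)

  pow-+ : ∀ a k m → pow a (k ℕ.+ m) ≋ (pow a k ⋆ pow a m)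
  pow-+ a zero    m = ≋-sym (⋆-identityˡ _)
  pow-+ a (suc k) m = ≋-trans (⋆-cong ≋-refl (pow-+ a k m)) (≋-sym (⋆-assoc a (pow a k) (pow a m)))

  pow-+-∸ : ∀ a {k n} → k ≤ n → pow a n ≋ (pow a k ⋆ pow a (n ∸ k))
  pow-+-∸ a {k} {n} k≤n = P.subst (λ m → pow a m ≋ (pow a k ⋆ pow a (n ∸ k))) (ℕ.m+[n∸m]≡n k≤n) (pow-+ a k (n ∸ k))

  pow-distrib-⋆ : ∀ a b k → pow (a ⋆ b) k ≋ (pow a k ⋆ pow b k)
  pow-distrib-⋆ a b zero    = ≋-sym (⋆-identityˡ _)
  pow-distrib-⋆ a b (suc k) =
    ≋-trans (⋆-cong ≋-refl (pow-distrib-⋆ a b k)) (⋆-interchange a b (pow a k) (pow b k))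

  pow-𝟙 : ∀ k → pow 𝟙 k ≋ 𝟙
  pow-𝟙 zero    = ≋-refl
  pow-𝟙 (suc k) = ≋-trans (⋆-cong ≋-refl (pow-𝟙 k)) (⋆-identityˡ 𝟙)

  pow-inverse : ∀ {a b} → (a ⋆ b) ≋ 𝟙 → ∀ k → (pow a k ⋆ pow b k) ≋ 𝟙
  pow-inverse {a} {b} ab≋1 k = ≋-trans (≋-sym (pow-distrib-⋆ a b k)) (≋-trans (pow-cong ab≋1 k) (pow-𝟙 k))

module Derivative {c ℓ} (R : CommutativeRing c ℓ) where
  open CommutativeRing R hiding (zero)
  open Series R
  open Sums R
  open SeriesRing R
  open CommSemigroupProperties *-commutativeSemigroup using (x∙yz≈y∙xz)

  ι : ℕ → Carrier
  ι m = m ·ℕ 1#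

  ·ℕ≈ι* : ∀ m x → m ·ℕ x ≈ ι m * x
  ·ℕ≈ι* zero    x = sym (zeroˡ x)
  ·ℕ≈ι* (suc m) x = trans (+-cong (sym (*-identityˡ x)) (·ℕ≈ι* m x)) (sym (distribʳ x 1# (ι m)))

  ι-+ : ∀ m k → ι (m ℕ.+ k) ≈ ι m + ι k
  ι-+ zero    k = sym (+-identityˡ _)
  ι-+ (suc m) k = trans (+-cong refl (ι-+ m k)) (sym (+-assoc _ _ _))

  ·ℕ-zeroʳ : ∀ m → m ·ℕ 0# ≈ 0#
  ·ℕ-zeroʳ m = trans (·ℕ≈ι* m 0#) (zeroʳ _)

  scale : Carrier → FPS → FPS
  scale x a n = x * a n

  ⋆-scale : ∀ a x b → (a ⋆ scale x b) ≋ scale x (a ⋆ b)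
  ⋆-scale a x b n = trans (Σ≤-cong n (λ i → x∙yz≈y∙xz _ _ _)) (sym (*-distribˡ-Σ≤ n x _))

  deriv-cong : ∀ {a b} → a ≋ b → deriv a ≋ deriv b
  deriv-cong a≋b n = trans (·ℕ≈ι* (suc n) _) (trans (*-cong refl (a≋b (suc n))) (sym (·ℕ≈ι* (suc n) _)))

  deriv-𝟙 : deriv 𝟙 ≋ 𝟘
  deriv-𝟙 n = ·ℕ-zeroʳ (suc n)

  deriv-X : deriv X ≋ 𝟙
  deriv-X zero    = +-identityʳ _
  deriv-X (suc n) = ·ℕ-zeroʳ (suc (suc n))

  deriv-⋆ : ∀ a b → deriv (a ⋆ b) ≋ ((deriv a ⋆ b) +ₛ (a ⋆ deriv b))
  deriv-⋆ a b n = begin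
    suc n ·ℕ (a ⋆ b) (suc n)
      ≈⟨ ·ℕ≈ι* (suc n) _ ⟩
    ι (suc n) * Σ≤ (suc n) (λ i → a i * b (suc n ∸ i))
      ≈⟨ *-distribˡ-Σ≤ (suc n) _ _ ⟩
    Σ≤ (suc n) (λ i → ι (suc n) * (a i * b (suc n ∸ i)))
      ≈⟨ Σ≤-cong-≤ (suc n) split-weight ⟩
    Σ≤ (suc n) (λ i → (ι i * a i) * b (suc n ∸ i) + a i * (ι (suc n ∸ i) * b (suc n ∸ i)))
      ≈⟨ Σ≤-distrib-+ (suc n) _ _ ⟩
    Σ≤ (suc n) (λ i → (ι i * a i) * b (suc n ∸ i)) + Σ≤ (suc n) (λ i → a i * (ι (suc n ∸ i) * b (suc n ∸ i)))
      ≈⟨ +-cong deriv-left deriv-right ⟩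
    (deriv a ⋆ b) n + (a ⋆ deriv b) n ∎
    where
    open SetoidReasoning setoid
    split-weight : ∀ i → i ≤ suc n →
      ι (suc n) * (a i * b (suc n ∸ i)) ≈ (ι i * a i) * b (suc n ∸ i) + a i * (ι (suc n ∸ i) * b (suc n ∸ i))
    split-weight i i≤ = begin
      ι (suc n) * (a i * b (suc n ∸ i))
        ≈⟨ *-cong (reflexive (P.cong ι (P.sym (ℕ.m+[n∸m]≡n i≤)))) refl ⟩
      ι (i ℕ.+ (suc n ∸ i)) * (a i * b (suc n ∸ i))
        ≈⟨ trans (*-cong (ι-+ i (suc n ∸ i)) refl) (distribʳ _ _ _) ⟩
      ι i * (a i * b (suc n ∸ i)) + ι (suc n ∸ i) * (a i * b (suc n ∸ i))
        ≈⟨ +-cong (sym (*-assoc _ _ _)) (x∙yz≈y∙xz _ _ _) ⟩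
      (ι i * a i) * b (suc n ∸ i) + a i * (ι (suc n ∸ i) * b (suc n ∸ i)) ∎
    deriv-left : Σ≤ (suc n) (λ i → (ι i * a i) * b (suc n ∸ i)) ≈ (deriv a ⋆ b) n
    deriv-left = trans (Σ≤-suc n _)
      (trans (+-cong (trans (*-cong (zeroˡ _) refl) (zeroˡ _))
                     (Σ≤-cong n (λ i → *-cong (sym (·ℕ≈ι* (suc i) _)) refl)))
             (+-identityˡ _))
    deriv-right : Σ≤ (suc n) (λ i → a i * (ι (suc n ∸ i) * b (suc n ∸ i))) ≈ (a ⋆ deriv b) n
    deriv-right = trans
      (+-cong (Σ≤-cong-≤ n (λ i i≤n → *-cong refl
                 (trans (reflexive (P.cong (λ m → ι m * b m) (ℕ.+-∸-assoc 1 i≤n)))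
                        (sym (·ℕ≈ι* (suc (n ∸ i)) _)))))
              (trans (*-cong refl (trans (*-cong (reflexive (P.cong ι (ℕ.n∸n≡0 n))) refl) (zeroˡ _)))
                     (zeroʳ _)))
      (+-identityʳ _)

  deriv-X⋆ : ∀ a → deriv (X ⋆ a) ≋ (a +ₛ X ⋆ deriv a)
  deriv-X⋆ a = ≋-trans (deriv-⋆ X a) (+ₛ-cong (≋-trans (⋆-congʳ a deriv-X) (⋆-identityˡ a)) (≋-refl {X ⋆ deriv a}))

  deriv-pow : ∀ a k → deriv (pow a (suc k)) ≋ scale (ι (suc k)) (pow a k ⋆ deriv a)
  deriv-pow a zero    n = trans (deriv-cong (⋆-identityʳ a) n)
    (sym (trans (*-cong (+-identityʳ 1#) (⋆-identityˡ (deriv a) n)) (*-identityˡ _)))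
  deriv-pow a (suc k) n = begin
    deriv (a ⋆ pow a (suc k)) n
      ≈⟨ deriv-⋆ a (pow a (suc k)) n ⟩
    (deriv a ⋆ pow a (suc k)) n + (a ⋆ deriv (pow a (suc k))) n
      ≈⟨ +-cong (⋆-comm (deriv a) _ n) (⋆-cong ≋-refl (deriv-pow a k) n) ⟩
    P n + (a ⋆ scale (ι (suc k)) (pow a k ⋆ deriv a)) n
      ≈⟨ +-cong refl (⋆-scale a (ι (suc k)) (pow a k ⋆ deriv a) n) ⟩
    P n + ι (suc k) * (a ⋆ (pow a k ⋆ deriv a)) n
      ≈⟨ +-cong refl (*-cong refl (⋆-assoc a (pow a k) (deriv a) n)) ⟨
    P n + ι (suc k) * P n
      ≈⟨ +-cong (*-identityˡ _) refl ⟨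
    1# * P n + ι (suc k) * P n
      ≈⟨ distribʳ _ _ _ ⟨
    ι (suc (suc k)) * P n ∎
    where
    open SetoidReasoning setoid
    P : FPS
    P = pow a (suc k) ⋆ deriv a

module Inverse {c ℓ} (R : CommutativeRing c ℓ) where
  open CommutativeRing R hiding (zero)
  open Series R
  open Sums R
  open SeriesRing R
  open RingProperties ring using (-‿distribʳ-*)
  open SetoidReasoning setoid

  sumᵥ : ∀ {m} → Vec.Vec Carrier m → Carrier
  sumᵥ = Vec.foldr _ _+_ 0#

  invUpTo-tabulate : ∀ a x n → invUpTo a x n ≡ Vec.tabulate (λ i → invS a x (n ∸ Fin.toℕ i))
  invUpTo-tabulate a x zero    = P.refl
  invUpTo-tabulate a x (suc n) = P.cong (invS a x (suc n) Vec.∷_) (invUpTo-tabulate a x n)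

  zipWith-*-tabulate : ∀ {k} (f g : Fin.Fin k → Carrier) →
                       Vec.zipWith _*_ (Vec.tabulate f) (Vec.tabulate g) ≡ Vec.tabulate (λ i → f i * g i)
  zipWith-*-tabulate {zero}  f g = P.refl
  zipWith-*-tabulate {suc k} f g =
    P.cong (f Fin.zero * g Fin.zero Vec.∷_) (zipWith-*-tabulate (f ∘ Fin.suc) (g ∘ Fin.suc))

  sumᵥ-tabulate : ∀ m (h : ℕ → Carrier) → sumᵥ (Vec.tabulate {n = suc m} (h ∘ Fin.toℕ)) ≈ Σ≤ m h
  sumᵥ-tabulate zero    h = +-identityʳ _
  sumᵥ-tabulate (suc m) h = trans (+-cong refl (sumᵥ-tabulate m (h ∘ suc))) (sym (Σ≤-suc m h))

  invUpTo-convolution : ∀ a x n →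
    sumᵥ (Vec.zipWith _*_ (Vec.map (λ i → a (suc (Fin.toℕ i))) (Vec.allFin (suc n))) (invUpTo a x n))
    ≈ Σ≤ n (λ i → a (suc i) * invS a x (n ∸ i))
  invUpTo-convolution a x n = begin
    sumᵥ (Vec.zipWith _*_ (Vec.map (λ i → a (suc (Fin.toℕ i))) (Vec.allFin (suc n))) (invUpTo a x n))
      ≡⟨ P.cong sumᵥ (P.cong₂ (Vec.zipWith _*_) (P.sym (Vec.tabulate-∘ _ (λ i → i))) (invUpTo-tabulate a x n)) ⟩
    sumᵥ {suc n} (Vec.zipWith _*_ (Vec.tabulate (λ i → a (suc (Fin.toℕ i))))
                                  (Vec.tabulate (λ i → invS a x (n ∸ Fin.toℕ i))))
      ≡⟨ P.cong sumᵥ (zipWith-*-tabulate {suc n} (λ i → a (suc (Fin.toℕ i))) (λ i → invS a x (n ∸ Fin.toℕ i))) ⟩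
    sumᵥ {suc n} (Vec.tabulate (λ i → a (suc (Fin.toℕ i)) * invS a x (n ∸ Fin.toℕ i)))
      ≈⟨ sumᵥ-tabulate n (λ i → a (suc i) * invS a x (n ∸ i)) ⟩
    Σ≤ n (λ i → a (suc i) * invS a x (n ∸ i)) ∎

  invS-inverse : ∀ a x → a 0 * x ≈ 1# → (a ⋆ invS a x) ≋ 𝟙
  invS-inverse a x a₀x≈1 zero    = a₀x≈1
  invS-inverse a x a₀x≈1 (suc n) = begin
    (a ⋆ invS a x) (suc n)
      ≈⟨ Σ≤-suc n _ ⟩
    a 0 * (- (x * S)) + C
      ≈⟨ +-cong (sym (-‿distribʳ-* _ _)) refl ⟩
    - (a 0 * (x * S)) + C
      ≈⟨ +-cong (-‿cong (trans (sym (*-assoc _ _ _)) (trans (*-cong a₀x≈1 refl) (*-identityˡ _)))) refl ⟩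
    - S + C
      ≈⟨ +-cong (-‿cong (invUpTo-convolution a x n)) refl ⟩
    - C + C
      ≈⟨ -‿inverseˡ _ ⟩
    0# ∎
    where
    S C : Carrier
    S = sumᵥ (Vec.zipWith _*_ (Vec.map (λ i → a (suc (Fin.toℕ i))) (Vec.allFin (suc n))) (invUpTo a x n))
    C = Σ≤ n (λ i → a (suc i) * invS a x (n ∸ i))

module Composition {c ℓ} (R : CommutativeRing c ℓ) where
  open CommutativeRing R hiding (zero)
  open Series R
  open Sums R
  open SeriesRing R
  open Derivative R
  open CommSemigroupProperties *-commutativeSemigroup using (x∙yz≈y∙xz)
  open SetoidReasoning setoid

  comp-congˡ : ∀ {a b} φ → a ≋ b → comp a φ ≋ comp b φ
  comp-congˡ φ a≋b n = Σ≤-cong n (λ k → *-cong (a≋b k) refl)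

  module _ (φ : FPS) (φ-ord≥1 : ord≥ φ 1) where

    comp-extend : ∀ g n N → n ≤ N → Σ≤ N (λ k → g k * pow φ k n) ≈ comp g φ n
    comp-extend g n N n≤N =
      Σ≤-extend _ n≤N (λ k n<k _ → trans (*-cong refl (pow-ord≥ φ-ord≥1 k n n<k)) (zeroʳ _))

    ⋆-comp : ∀ w g n → (w ⋆ comp g φ) n ≈ Σ≤ n (λ i → g i * (w ⋆ pow φ i) n)
    ⋆-comp w g n = begin
      Σ≤ n (λ j → w j * comp g φ (n ∸ j))
        ≈⟨ Σ≤-cong n (λ j → *-cong refl (sym (comp-extend g (n ∸ j) n (ℕ.m∸n≤m n j)))) ⟩
      Σ≤ n (λ j → w j * Σ≤ n (λ i → g i * pow φ i (n ∸ j)))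
        ≈⟨ Σ≤-cong n (λ j → *-distribˡ-Σ≤ n _ _) ⟩
      Σ≤ n (λ j → Σ≤ n (λ i → w j * (g i * pow φ i (n ∸ j))))
        ≈⟨ Σ≤-comm n n _ ⟩
      Σ≤ n (λ i → Σ≤ n (λ j → w j * (g i * pow φ i (n ∸ j))))
        ≈⟨ Σ≤-cong n (λ i → trans (Σ≤-cong n (λ j → x∙yz≈y∙xz _ _ _)) (sym (*-distribˡ-Σ≤ n _ _))) ⟩
      Σ≤ n (λ i → g i * Σ≤ n (λ j → w j * pow φ i (n ∸ j))) ∎

    comp-⋆ : ∀ a b → comp (a ⋆ b) φ ≋ (comp a φ ⋆ comp b φ)
    comp-⋆ a b n = begin
      Σ≤ n (λ k → Σ≤ k (λ j → a j * b (k ∸ j)) * pow φ k n)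
        ≈⟨ Σ≤-cong n (λ k → *-distribʳ-Σ≤ k _ _) ⟩
      Σ≤ n (λ k → Σ≤ k (λ j → a j * b (k ∸ j) * pow φ k n))
        ≈⟨ Σ≤-triangle n _ ⟩
      Σ≤ n (λ j → Σ≤ (n ∸ j) (λ i → a j * b (j ℕ.+ i ∸ j) * pow φ (j ℕ.+ i) n))
        ≈⟨ Σ≤-cong n (λ j → Σ≤-cong (n ∸ j) (regroup j)) ⟩
      Σ≤ n (λ j → Σ≤ (n ∸ j) (T j))
        ≈⟨ Σ≤-cong-≤ n (λ j j≤n → sym (Σ≤-extend _ (ℕ.m∸n≤m n j) (λ i n∸j<i _ → T-vanishes j i j≤n n∸j<i))) ⟩
      Σ≤ n (λ j → Σ≤ n (T j))
        ≈⟨ Σ≤-comm n n _ ⟩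
      Σ≤ n (λ i → Σ≤ n (λ j → T j i))
        ≈⟨ Σ≤-cong n (λ i → sym (*-distribˡ-Σ≤ n _ _)) ⟩
      Σ≤ n (λ i → b i * Σ≤ n (λ j → a j * (pow φ i ⋆ pow φ j) n))
        ≈⟨ Σ≤-cong n (λ i → *-cong refl (trans (sym (⋆-comp (pow φ i) a n)) (⋆-comm (pow φ i) (comp a φ) n))) ⟩
      Σ≤ n (λ i → b i * (comp a φ ⋆ pow φ i) n)
        ≈⟨ ⋆-comp (comp a φ) b n ⟨
      (comp a φ ⋆ comp b φ) n ∎
      where
      T : ℕ → ℕ → Carrier
      T j i = b i * (a j * (pow φ i ⋆ pow φ j) n)
      regroup : ∀ j i → a j * b (j ℕ.+ i ∸ j) * pow φ (j ℕ.+ i) n ≈ T j i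
      regroup j i = trans (*-cong (*-cong refl (reflexive (P.cong b (ℕ.m+n∸m≡n j i))))
                                  (trans (pow-+ φ j i n) (⋆-comm (pow φ j) (pow φ i) n)))
                          (trans (*-assoc _ _ _) (x∙yz≈y∙xz _ _ _))
      T-vanishes : ∀ j i → j ≤ n → n ∸ j < i → T j i ≈ 0#
      T-vanishes j i j≤n n∸j<i =
        trans (*-cong refl (trans (*-cong refl (⋆-ord≥ (pow-ord≥ φ-ord≥1 i) (pow-ord≥ φ-ord≥1 j) n n<i+j))
                                  (zeroʳ _)))
              (zeroʳ _)
        where
        n<i+j : n < i ℕ.+ j
        n<i+j = P.subst (_< i ℕ.+ j) (ℕ.m∸n+n≡m j≤n) (ℕ.+-monoˡ-< j n∸j<i)

    comp-𝟙 : comp 𝟙 φ ≋ 𝟙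
    comp-𝟙 zero    = *-identityˡ _
    comp-𝟙 (suc n) =
      trans (Σ≤-suc n _) (trans (+-cong (zeroʳ _) (Σ≤-zero n (λ i _ → zeroˡ _))) (+-identityˡ _))

    comp-identityˡ : comp X φ ≋ φ
    comp-identityˡ zero    = trans (zeroˡ _) (sym (φ-ord≥1 0 (s≤s z≤n)))
    comp-identityˡ (suc n) = trans (Σ≤-suc n _)
      (trans (+-cong (zeroˡ _) (Σ≤-X-suc n (λ k → pow φ (suc k) (suc n))))
             (trans (+-identityˡ _) (⋆-identityʳ φ (suc n))))

    comp-pow : ∀ a k → comp (pow a k) φ ≋ pow (comp a φ) k
    comp-pow a zero    = comp-𝟙
    comp-pow a (suc k) = ≋-trans (comp-⋆ a (pow a k)) (⋆-cong ≋-refl (comp-pow a k))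

    deriv-comp : ∀ a → deriv (comp a φ) ≋ (comp (deriv a) φ ⋆ deriv φ)
    deriv-comp a n = begin
      suc n ·ℕ comp a φ (suc n)
        ≈⟨ ·ℕ≈ι* (suc n) _ ⟩
      ι (suc n) * Σ≤ (suc n) (λ k → a k * pow φ k (suc n))
        ≈⟨ *-distribˡ-Σ≤ (suc n) _ _ ⟩
      Σ≤ (suc n) (λ k → ι (suc n) * (a k * pow φ k (suc n)))
        ≈⟨ Σ≤-cong (suc n) (λ k → trans (x∙yz≈y∙xz _ _ _) (*-cong refl (sym (·ℕ≈ι* (suc n) _)))) ⟩
      Σ≤ (suc n) (λ k → a k * deriv (pow φ k) n)
        ≈⟨ Σ≤-suc n _ ⟩
      a 0 * deriv 𝟙 n + Σ≤ n (λ k → a (suc k) * deriv (pow φ (suc k)) n)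
        ≈⟨ +-cong (trans (*-cong refl (deriv-𝟙 n)) (zeroʳ _)) (Σ≤-cong n (λ k → *-cong refl (deriv-pow φ k n))) ⟩
      0# + Σ≤ n (λ k → a (suc k) * (ι (suc k) * (pow φ k ⋆ deriv φ) n))
        ≈⟨ +-identityˡ _ ⟩
      Σ≤ n (λ k → a (suc k) * (ι (suc k) * (pow φ k ⋆ deriv φ) n))
        ≈⟨ Σ≤-cong n (λ k → trans (sym (*-assoc _ _ _))
             (*-cong (trans (*-comm _ _) (sym (·ℕ≈ι* (suc k) _))) (⋆-comm (pow φ k) (deriv φ) n))) ⟩
      Σ≤ n (λ k → deriv a k * (deriv φ ⋆ pow φ k) n)
        ≈⟨ ⋆-comp (deriv φ) (deriv a) n ⟨
      (deriv φ ⋆ comp (deriv a) φ) n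
        ≈⟨ ⋆-comm (deriv φ) _ n ⟩
      (comp (deriv a) φ ⋆ deriv φ) n ∎

module RiordanArrays {c ℓ} (R : CommutativeRing c ℓ) where
  open CommutativeRing R hiding (zero)
  open Series R
  open Sums R
  open SeriesRing R
  open Composition R
  open SetoidReasoning setoid

  riordan-cong : ∀ {a a′ f f′} → a ≋ a′ → f ≋ f′ → riordan a f ≋ₘ riordan a′ f′
  riordan-cong a≋a′ f≋f′ n k = ⋆-cong a≋a′ (pow-cong f≋f′ k) n

  riordan-lower-triangular : ∀ a {f} → ord≥ f 1 → ∀ n k → n < k → riordan a f n k ≈ 0#
  riordan-lower-triangular a f-ord≥1 n k n<k = ⋆-ord≥ (ord≥-0 a) (pow-ord≥ f-ord≥1 k) n n<k

  riordan-× : ∀ a b {φ} h → ord≥ φ 1 → (riordan a φ ×ₘ riordan b h) ≋ₘ riordan (a ⋆ comp b φ) (comp h φ)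
  riordan-× a b {φ} h φ-ord≥1 n k = begin
    Σ≤ n (λ j → (a ⋆ pow φ j) n * (b ⋆ pow h k) j)   ≈⟨ Σ≤-cong n (λ j → *-comm _ _) ⟩
    Σ≤ n (λ j → (b ⋆ pow h k) j * (a ⋆ pow φ j) n)   ≈⟨ ⋆-comp φ φ-ord≥1 a (b ⋆ pow h k) n ⟨
    (a ⋆ comp (b ⋆ pow h k) φ) n
      ≈⟨ ⋆-cong ≋-refl (≋-trans (comp-⋆ φ φ-ord≥1 b (pow h k)) (⋆-cong ≋-refl (comp-pow φ φ-ord≥1 h k))) n ⟩
    (a ⋆ (comp b φ ⋆ pow (comp h φ) k)) n           ≈⟨ ⋆-assoc a (comp b φ) (pow (comp h φ) k) n ⟨
    ((a ⋆ comp b φ) ⋆ pow (comp h φ) k) n           ∎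

  riordan-comp-X-× : ∀ g {φ} u → ord≥ φ 1 → ∀ n k →
    (riordan (comp g φ) X ×ₘ riordan u φ) n k ≈ Σ≤ n (λ i → g i * riordan u φ n (k ℕ.+ i))
  riordan-comp-X-× g {φ} u φ-ord≥1 n k = begin
    Σ≤ n (λ j → (comp g φ ⋆ pow X j) n * (u ⋆ pow φ k) j)
      ≈⟨ Σ≤-cong-≤ n (λ j j≤n → trans (*-comm _ _)
           (*-cong refl (trans (⋆-comm (comp g φ) (pow X j) n) (pow-X⋆-∸ j (comp g φ) n j≤n)))) ⟩
    ((u ⋆ pow φ k) ⋆ comp g φ) n
      ≈⟨ ⋆-comp φ φ-ord≥1 (u ⋆ pow φ k) g n ⟩
    Σ≤ n (λ i → g i * ((u ⋆ pow φ k) ⋆ pow φ i) n)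
      ≈⟨ Σ≤-cong n (λ i → *-cong refl (≋-trans (⋆-assoc u (pow φ k) (pow φ i)) (⋆-cong ≋-refl (≋-sym (pow-+ φ k i))) n)) ⟩
    Σ≤ n (λ i → g i * (u ⋆ pow φ (k ℕ.+ i)) n) ∎

  verticalHalf-≤ : ∀ t n k → k ≤ n ℕ.+ n → verticalHalf t n k ≈ t (n ℕ.+ n ∸ k) n
  verticalHalf-≤ t n k k≤2n with k ℕ.≤? (n ℕ.+ n)
  ... | yes _    = refl
  ... | no  k≰2n = ⊥-elim (k≰2n k≤2n)

  verticalHalf-> : ∀ t n k → ¬ k ≤ n ℕ.+ n → verticalHalf t n k ≈ 0#
  verticalHalf-> t n k k≰2n with k ℕ.≤? (n ℕ.+ n)
  ... | yes k≤2n = ⊥-elim (k≰2n k≤2n)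
  ... | no  _    = refl

  module _ (g : FPS) {f ψ : FPS} (f≋Xψ : f ≋ (X ⋆ ψ)) where

    riordan-X⋆ : ∀ m n → riordan g f m n ≈ (pow X n ⋆ (g ⋆ pow ψ n)) m
    riordan-X⋆ m n = ≋-trans (⋆-cong ≋-refl (≋-trans (pow-cong f≋Xψ n) (pow-distrib-⋆ X ψ n)))
                             (⋆-lcomm g (pow X n) (pow ψ n)) m

    verticalHalf-riordan-≤ : ∀ n k → k ≤ n → verticalHalf (riordan g f) n k ≈ (g ⋆ pow ψ n) (n ∸ k)
    verticalHalf-riordan-≤ n k k≤n = begin
      verticalHalf (riordan g f) n k       ≈⟨ verticalHalf-≤ (riordan g f) n k (ℕ.≤-trans k≤n (ℕ.m≤n+m n n)) ⟩
      riordan g f (n ℕ.+ n ∸ k) n          ≈⟨ riordan-X⋆ (n ℕ.+ n ∸ k) n ⟩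
      (pow X n ⋆ (g ⋆ pow ψ n)) (n ℕ.+ n ∸ k)
        ≡⟨ P.cong (pow X n ⋆ (g ⋆ pow ψ n)) (ℕ.+-∸-assoc n k≤n) ⟩
      (pow X n ⋆ (g ⋆ pow ψ n)) (n ℕ.+ (n ∸ k)) ≈⟨ pow-X⋆-+ n (g ⋆ pow ψ n) (n ∸ k) ⟩
      (g ⋆ pow ψ n) (n ∸ k)                ∎

    verticalHalf-riordan-> : ∀ n k → n < k → verticalHalf (riordan g f) n k ≈ 0#
    verticalHalf-riordan-> n k n<k = by-cases (k ℕ.≤? (n ℕ.+ n))
      where
      by-cases : Dec (k ≤ n ℕ.+ n) → verticalHalf (riordan g f) n k ≈ 0#
      by-cases (no  k≰2n) = verticalHalf-> (riordan g f) n k k≰2n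
      by-cases (yes k≤2n) = begin
        verticalHalf (riordan g f) n k          ≈⟨ verticalHalf-≤ (riordan g f) n k k≤2n ⟩
        riordan g f (n ℕ.+ n ∸ k) n             ≈⟨ riordan-X⋆ (n ℕ.+ n ∸ k) n ⟩
        (pow X n ⋆ (g ⋆ pow ψ n)) (n ℕ.+ n ∸ k) ≈⟨ pow-X⋆-< n (g ⋆ pow ψ n) (n ℕ.+ n ∸ k) 2n∸k<n ⟩
        0#                                      ∎
        where
        2n∸k<n : n ℕ.+ n ∸ k < n
        2n∸k<n = P.subst (n ℕ.+ n ∸ k <_) (ℕ.m+n∸m≡n n n) (ℕ.∸-monoʳ-< n<k k≤2n)

module LagrangeInversion {c ℓ} (F : Field c ℓ) where
  open FieldOps F hiding (zero)
  open Sums commRing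
  open SeriesRing commRing
  open Derivative commRing
  open Inverse commRing
  open Composition commRing
  open RiordanArrays commRing
  open NatCoeffSolver (CommutativeRing.commutativeSemiring FPS-commutativeRing) using (solve; _:=_; _:+_; _:*_)

  xφ'/φ⋆divX : ∀ φ (φ₁≉0 : ¬ φ 1 ≈ 0#) → (xφ'/φ φ φ₁≉0 ⋆ divX φ) ≋ deriv φ
  xφ'/φ⋆divX φ φ₁≉0 = begin
    (deriv φ ⋆ invS (divX φ) y) ⋆ divX φ    ≈⟨ ⋆-assoc (deriv φ) (invS (divX φ) y) (divX φ) ⟩
    deriv φ ⋆ (invS (divX φ) y ⋆ divX φ)    ≈⟨ ⋆-congˡ (deriv φ) (⋆-comm (invS (divX φ) y) (divX φ)) ⟩
    deriv φ ⋆ (divX φ ⋆ invS (divX φ) y)    ≈⟨ ⋆-congˡ (deriv φ) (invS-inverse (divX φ) y (proj₂ (inv (φ 1) φ₁≉0))) ⟩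
    deriv φ ⋆ 𝟙                             ≈⟨ ⋆-identityʳ (deriv φ) ⟩
    deriv φ                                 ∎
    where
    open ≋-Reasoning
    y : Carrier
    y = proj₁ (inv (φ 1) φ₁≉0)

  ι-suc-cancelˡ : ∀ e {x y} → ι (suc e) * x ≈ ι (suc e) * y → x ≈ y
  ι-suc-cancelˡ e {x} {y} eq = begin
    x                         ≈⟨ *-identityˡ x ⟨
    1# * x                    ≈⟨ *-cong z*ι≈1 refl ⟨
    (z * ι (suc e)) * x       ≈⟨ *-assoc _ _ _ ⟩
    z * (ι (suc e) * x)       ≈⟨ *-cong refl eq ⟩
    z * (ι (suc e) * y)       ≈⟨ *-assoc _ _ _ ⟨
    (z * ι (suc e)) * y       ≈⟨ *-cong z*ι≈1 refl ⟩
    1# * y                    ≈⟨ *-identityˡ y ⟩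
    y                         ∎
    where
    open SetoidReasoning setoid
    z : Carrier
    z = proj₁ (inv (ι (suc e)) (charZero e))
    z*ι≈1 : z * ι (suc e) ≈ 1#
    z*ι≈1 = trans (*-comm _ _) (proj₂ (inv (ι (suc e)) (charZero e)))

  module _ (ψ w : FPS) (ψ⋆w≋𝟙 : (ψ ⋆ w) ≋ 𝟙) where

    h : FPS
    h = X ⋆ w

    -- h′ψ = x h′/h, since h = x/ψ.
    h′ψ : FPS
    h′ψ = deriv h ⋆ ψ

    h-ord≥1 : ord≥ h 1
    h-ord≥1 = ⋆-ord≥ X-ord≥1 (ord≥-0 w)

    h′ψ⋆pow-ψ : ∀ d → (h′ψ ⋆ pow ψ d) ≋ (pow ψ d +ₛ (X ⋆ ((ψ ⋆ deriv w) ⋆ pow ψ d)))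
    h′ψ⋆pow-ψ d = begin
      (deriv (X ⋆ w) ⋆ ψ) ⋆ pow ψ d
        ≈⟨ ⋆-congʳ (pow ψ d) (⋆-congʳ ψ (deriv-X⋆ w)) ⟩
      ((w +ₛ X ⋆ deriv w) ⋆ ψ) ⋆ pow ψ d
        ≈⟨ solve 5 (λ w X w′ ψ P → ((w :+ X :* w′) :* ψ) :* P := (ψ :* w) :* P :+ X :* ((ψ :* w′) :* P))
                 ≋-refl w X (deriv w) ψ (pow ψ d) ⟩
      (ψ ⋆ w) ⋆ pow ψ d +ₛ X ⋆ ((ψ ⋆ deriv w) ⋆ pow ψ d)
        ≈⟨ +ₛ-cong (≋-trans (⋆-congʳ (pow ψ d) ψ⋆w≋𝟙) (⋆-identityˡ _)) (≋-refl {X ⋆ ((ψ ⋆ deriv w) ⋆ pow ψ d)}) ⟩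
      pow ψ d +ₛ X ⋆ ((ψ ⋆ deriv w) ⋆ pow ψ d) ∎
      where open ≋-Reasoning

    pow-ψ⋆ψ′-cancel : ∀ e → (pow ψ e ⋆ deriv ψ +ₛ (ψ ⋆ deriv w) ⋆ pow ψ (suc e)) ≋ 𝟘
    pow-ψ⋆ψ′-cancel e = begin
      pow ψ e ⋆ deriv ψ +ₛ (ψ ⋆ deriv w) ⋆ (ψ ⋆ pow ψ e)
        ≈⟨ +ₛ-cong (≋-trans (⋆-congʳ P ψ⋆w≋𝟙) (⋆-identityˡ P)) (≋-refl {(ψ ⋆ deriv w) ⋆ (ψ ⋆ pow ψ e)}) ⟨
      (ψ ⋆ w) ⋆ P +ₛ (ψ ⋆ deriv w) ⋆ (ψ ⋆ pow ψ e)
        ≈⟨ solve 5 (λ ψ′ w ψ w′ P → (ψ :* w) :* (P :* ψ′) :+ (ψ :* w′) :* (ψ :* P)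
                                 := (ψ′ :* w :+ ψ :* w′) :* (ψ :* P))
                 ≋-refl (deriv ψ) w ψ (deriv w) (pow ψ e) ⟩
      (deriv ψ ⋆ w +ₛ ψ ⋆ deriv w) ⋆ (ψ ⋆ pow ψ e)
        ≈⟨ ⋆-congʳ (ψ ⋆ pow ψ e) (≋-trans (≋-sym (deriv-⋆ ψ w)) (≋-trans (deriv-cong ψ⋆w≋𝟙) deriv-𝟙)) ⟩
      𝟘 ⋆ (ψ ⋆ pow ψ e)
        ≈⟨ ⋆-zeroˡ (ψ ⋆ pow ψ e) ⟩
      𝟘 ∎
      where
      open ≋-Reasoning
      P : FPS
      P = pow ψ e ⋆ deriv ψ

    -- (xh′/h) ψ^d = ψ^d + x·ψw′ψ^d. For d = e+1, (e+1)·[x^(e+1)] ψ^(e+1) = [x^e] (ψ^(e+1))′ = (e+1)·[x^e] ψ^e ψ′,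
    -- and ψ^e ψ′ + ψw′ψ^(e+1) = ψ^(e+1) (ψw)′ = 0; characteristic zero cancels the factor e+1.
    lagrange-diagonal : ∀ d → (h′ψ ⋆ pow ψ d) d ≈ 𝟙 d
    lagrange-diagonal zero    =
      trans (h′ψ⋆pow-ψ 0 0) (trans (+-cong refl (X⋆-zero ((ψ ⋆ deriv w) ⋆ pow ψ 0))) (+-identityʳ _))
    lagrange-diagonal (suc e) =
      trans (h′ψ⋆pow-ψ (suc e) (suc e)) (trans (+-cong refl (X⋆-suc M e)) (ι-suc-cancelˡ e scaled))
      where
      open SetoidReasoning setoid
      M : FPS
      M = (ψ ⋆ deriv w) ⋆ pow ψ (suc e)
      scaled : ι (suc e) * (pow ψ (suc e) (suc e) + M e) ≈ ι (suc e) * 0#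
      scaled = begin
        ι (suc e) * (pow ψ (suc e) (suc e) + M e)
          ≈⟨ distribˡ _ _ _ ⟩
        ι (suc e) * pow ψ (suc e) (suc e) + ι (suc e) * M e
          ≈⟨ +-cong (trans (sym (·ℕ≈ι* (suc e) _)) (deriv-pow ψ e e)) refl ⟩
        ι (suc e) * (pow ψ e ⋆ deriv ψ) e + ι (suc e) * M e
          ≈⟨ distribˡ _ _ _ ⟨
        ι (suc e) * ((pow ψ e ⋆ deriv ψ) e + M e)
          ≈⟨ *-cong refl (pow-ψ⋆ψ′-cancel e e) ⟩
        ι (suc e) * 0# ∎

    module _ (φ : FPS) (φ₀≈0 : φ 0 ≈ 0#) (h∘φ≋X : comp h φ ≋ X) where

      φ-ord≥1 : ord≥ φ 1
      φ-ord≥1 zero    _        = φ₀≈0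
      φ-ord≥1 (suc i) (s≤s ())

      divX-φ⋆w∘φ≋𝟙 : (divX φ ⋆ comp w φ) ≋ 𝟙
      divX-φ⋆w∘φ≋𝟙 = X⋆-cancel (begin
        X ⋆ (divX φ ⋆ comp w φ)     ≈⟨ ⋆-assoc X (divX φ) (comp w φ) ⟨
        (X ⋆ divX φ) ⋆ comp w φ     ≈⟨ ⋆-congʳ (comp w φ) (X⋆-divX φ₀≈0) ⟨
        φ ⋆ comp w φ                ≈⟨ ⋆-congʳ (comp w φ) (comp-identityˡ φ φ-ord≥1) ⟨
        comp X φ ⋆ comp w φ         ≈⟨ comp-⋆ φ φ-ord≥1 X w ⟨
        comp h φ                    ≈⟨ h∘φ≋X ⟩
        X                           ≈⟨ ⋆-identityʳ X ⟨
        X ⋆ 𝟙                       ∎)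
        where open ≋-Reasoning

      φ₁≉0 : ¬ φ 1 ≈ 0#
      φ₁≉0 φ₁≈0 = 0≉1 (begin
        0#                  ≈⟨ zeroˡ _ ⟨
        0# * comp w φ 0     ≈⟨ *-cong φ₁≈0 refl ⟨
        φ 1 * comp w φ 0    ≈⟨ divX-φ⋆w∘φ≋𝟙 0 ⟩
        1#                  ∎)
        where open SetoidReasoning setoid

      ψ∘φ≋divX-φ : comp ψ φ ≋ divX φ
      ψ∘φ≋divX-φ = inverse-unique
        {b = comp w φ} (≋-trans (≋-sym (comp-⋆ φ φ-ord≥1 ψ w)) (≋-trans (comp-congˡ φ ψ⋆w≋𝟙) (comp-𝟙 φ φ-ord≥1)))
        divX-φ⋆w∘φ≋𝟙

      module _ (u : FPS) (u⋆divX-φ≋φ′ : (u ⋆ divX φ) ≋ deriv φ) where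

        u⋆h′ψ∘φ≋𝟙 : (u ⋆ comp h′ψ φ) ≋ 𝟙
        u⋆h′ψ∘φ≋𝟙 = begin
          u ⋆ comp (deriv h ⋆ ψ) φ              ≈⟨ ⋆-congˡ u (comp-⋆ φ φ-ord≥1 (deriv h) ψ) ⟩
          u ⋆ (comp (deriv h) φ ⋆ comp ψ φ)     ≈⟨ ⋆-congˡ u (⋆-congˡ (comp (deriv h) φ) ψ∘φ≋divX-φ) ⟩
          u ⋆ (comp (deriv h) φ ⋆ divX φ)       ≈⟨ ⋆-lcomm u (comp (deriv h) φ) (divX φ) ⟩
          comp (deriv h) φ ⋆ (u ⋆ divX φ)       ≈⟨ ⋆-congˡ (comp (deriv h) φ) u⋆divX-φ≋φ′ ⟩
          comp (deriv h) φ ⋆ deriv φ            ≈⟨ deriv-comp φ φ-ord≥1 h ⟨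
          deriv (comp h φ)                      ≈⟨ deriv-cong h∘φ≋X ⟩
          deriv X                               ≈⟨ deriv-X ⟩
          𝟙                                     ∎
          where open ≋-Reasoning

        riordan-u-φ-×-h′ψ-h : (riordan u φ ×ₘ riordan h′ψ h) ≋ₘ riordan 𝟙 X
        riordan-u-φ-×-h′ψ-h n k = trans (riordan-× u h′ψ h φ-ord≥1 n k) (riordan-cong u⋆h′ψ∘φ≋𝟙 h∘φ≋X n k)

        riordan-h′ψ-h-diagonal-invertible : ∀ j → Σ Carrier λ y → riordan h′ψ h j j * y ≈ 1#
        riordan-h′ψ-h-diagonal-invertible j = pow ψ j 0 , (begin
          riordan h′ψ h j j * pow ψ j 0
            ≈⟨ *-cong (riordan-X⋆ h′ψ {h} {w} ≋-refl j j) refl ⟩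
          (pow X j ⋆ (h′ψ ⋆ pow w j)) j * pow ψ j 0
            ≈⟨ *-cong (pow-X⋆-∸ j (h′ψ ⋆ pow w j) j ℕ.≤-refl) refl ⟩
          (h′ψ ⋆ pow w j) (j ∸ j) * pow ψ j 0
            ≡⟨ P.cong (λ i → (h′ψ ⋆ pow w j) i * pow ψ j 0) (ℕ.n∸n≡0 j) ⟩
          ((h′ψ ⋆ pow w j) ⋆ pow ψ j) 0
            ≈⟨ ≋-trans (⋆-assoc h′ψ (pow w j) (pow ψ j)) (⋆-congˡ h′ψ (⋆-comm (pow w j) (pow ψ j))) 0 ⟩
          (h′ψ ⋆ (pow ψ j ⋆ pow w j)) 0
            ≈⟨ ⋆-congˡ h′ψ (pow-inverse ψ⋆w≋𝟙 j) 0 ⟩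
          (h′ψ ⋆ pow ψ 0) 0
            ≈⟨ lagrange-diagonal 0 ⟩
          1# ∎)
          where open SetoidReasoning setoid

        ψ-powers-×-riordan-h′ψ-h : ∀ n k → Σ≤ n (λ j → pow ψ n (n ∸ j) * riordan h′ψ h j k) ≈ riordan 𝟙 X n k
        ψ-powers-×-riordan-h′ψ-h n k with ℕ.≤-<-connex k n
        ... | inj₂ n<k = trans
          (Σ≤-zero n (λ j j≤n → trans (*-cong refl (riordan-lower-triangular h′ψ h-ord≥1 j k (ℕ.≤-<-trans j≤n n<k)))
                                       (zeroʳ _)))
          (sym (riordan-lower-triangular 𝟙 X-ord≥1 n k n<k))
        ... | inj₁ k≤n = begin
          Σ≤ n (λ j → pow ψ n (n ∸ j) * riordan h′ψ h j k)
            ≈⟨ Σ≤-cong n (λ j → *-comm _ _) ⟩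
          ((h′ψ ⋆ pow h k) ⋆ pow ψ n) n
            ≈⟨ ⋆-cong (λ m → riordan-X⋆ h′ψ {h} {w} ≋-refl m k) (pow-+-∸ ψ k≤n) n ⟩
          ((pow X k ⋆ (h′ψ ⋆ pow w k)) ⋆ (pow ψ k ⋆ pow ψ d)) n
            ≈⟨ solve 5 (λ x v w p q → (x :* (v :* w)) :* (p :* q) := x :* ((v :* q) :* (p :* w)))
                     ≋-refl (pow X k) h′ψ (pow w k) (pow ψ k) (pow ψ d) n ⟩
          (pow X k ⋆ ((h′ψ ⋆ pow ψ d) ⋆ (pow ψ k ⋆ pow w k))) n
            ≈⟨ ⋆-congˡ (pow X k) (≋-trans (⋆-congˡ (h′ψ ⋆ pow ψ d) (pow-inverse ψ⋆w≋𝟙 k)) (⋆-identityʳ _)) n ⟩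
          (pow X k ⋆ (h′ψ ⋆ pow ψ d)) n
            ≈⟨ pow-X⋆-∸ k (h′ψ ⋆ pow ψ d) n k≤n ⟩
          (h′ψ ⋆ pow ψ d) d
            ≈⟨ lagrange-diagonal d ⟩
          𝟙 d
            ≈⟨ pow-X⋆-∸ k 𝟙 n k≤n ⟨
          (pow X k ⋆ 𝟙) n
            ≈⟨ ⋆-comm (pow X k) 𝟙 n ⟩
          riordan 𝟙 X n k ∎
          where
          open SetoidReasoning setoid
          d : ℕ
          d = n ∸ k

        lagrange-inversion : ∀ n m → m ≤ n → riordan u φ n m ≈ pow ψ n (n ∸ m)
        lagrange-inversion n m m≤n = sym (triangular-cancel n (riordan h′ψ h)
          riordan-h′ψ-h-diagonal-invertible (riordan-lower-triangular h′ψ h-ord≥1)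
          (λ j → pow ψ n (n ∸ j)) (riordan u φ n)
          (λ k → trans (ψ-powers-×-riordan-h′ψ-h n k) (sym (riordan-u-φ-×-h′ψ-h n k))) m m≤n)

        ⋆-pow-ψ-coefficient : ∀ g n k → k ≤ n →
                              (g ⋆ pow ψ n) (n ∸ k) ≈ Σ≤ n (λ i → g i * riordan u φ n (k ℕ.+ i))
        ⋆-pow-ψ-coefficient g n k k≤n = begin
          Σ≤ (n ∸ k) (λ i → g i * pow ψ n (n ∸ k ∸ i))
            ≈⟨ Σ≤-cong-≤ (n ∸ k) (λ i i≤n∸k → *-cong refl (begin
                 pow ψ n (n ∸ k ∸ i)        ≡⟨ P.cong (pow ψ n) (ℕ.∸-+-assoc n k i) ⟩
                 pow ψ n (n ∸ (k ℕ.+ i))    ≈⟨ lagrange-inversion n (k ℕ.+ i) (k+i≤n i≤n∸k) ⟨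
                 riordan u φ n (k ℕ.+ i)    ∎)) ⟩
          Σ≤ (n ∸ k) (λ i → g i * riordan u φ n (k ℕ.+ i))
            ≈⟨ Σ≤-extend _ (ℕ.m∸n≤m n k) (λ i n∸k<i _ → trans
                 (*-cong refl (riordan-lower-triangular u φ-ord≥1 n (k ℕ.+ i) (n<k+i n∸k<i))) (zeroʳ _)) ⟨
          Σ≤ n (λ i → g i * riordan u φ n (k ℕ.+ i)) ∎
          where
          open SetoidReasoning setoid
          k+i≤n : ∀ {i} → i ≤ n ∸ k → k ℕ.+ i ≤ n
          k+i≤n i≤n∸k = P.subst (_ ≤_) (ℕ.m+[n∸m]≡n k≤n) (ℕ.+-monoʳ-≤ k i≤n∸k)
          n<k+i : ∀ {i} → n ∸ k < i → n < k ℕ.+ i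
          n<k+i n∸k<i = P.subst (_< _) (ℕ.m+[n∸m]≡n k≤n) (ℕ.+-monoʳ-< k n∸k<i)

        verticalHalf-factorisation : ∀ g {f} → f ≋ (X ⋆ ψ) →
                                     verticalHalf (riordan g f) ≋ₘ (riordan (comp g φ) X ×ₘ riordan u φ)
        verticalHalf-factorisation g {f} f≋Xψ n k with ℕ.≤-<-connex k n
        ... | inj₁ k≤n = begin
          verticalHalf (riordan g f) n k              ≈⟨ verticalHalf-riordan-≤ g {f} {ψ} f≋Xψ n k k≤n ⟩
          (g ⋆ pow ψ n) (n ∸ k)                       ≈⟨ ⋆-pow-ψ-coefficient g n k k≤n ⟩
          Σ≤ n (λ i → g i * riordan u φ n (k ℕ.+ i))  ≈⟨ riordan-comp-X-× g u φ-ord≥1 n k ⟨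
          (riordan (comp g φ) X ×ₘ riordan u φ) n k   ∎
          where open SetoidReasoning setoid
        ... | inj₂ n<k = begin
          verticalHalf (riordan g f) n k              ≈⟨ verticalHalf-riordan-> g {f} {ψ} f≋Xψ n k n<k ⟩
          0#                                          ≈⟨ Σ≤-zero n (λ i _ → trans (*-cong refl (u-vanishes i)) (zeroʳ _)) ⟨
          Σ≤ n (λ i → g i * riordan u φ n (k ℕ.+ i))  ≈⟨ riordan-comp-X-× g u φ-ord≥1 n k ⟨
          (riordan (comp g φ) X ×ₘ riordan u φ) n k   ∎
          where
          open SetoidReasoning setoid
          u-vanishes : ∀ i → riordan u φ n (k ℕ.+ i) ≈ 0#
          u-vanishes i = riordan-lower-triangular u φ-ord≥1 n (k ℕ.+ i) (ℕ.<-≤-trans n<k (ℕ.m≤m+n k i))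

mainTheorem1 : ∀ {c ℓ} (F : Field c ℓ) → let open FieldOps F in
    (g f : FPS) → ¬ (g 0 ≈ 0#) → f 0 ≈ 0# → (f1 : ¬ (f 1 ≈ 0#)) →
    (φ : FPS) → IsRev (x²/ f f1) φ →
    Σ (¬ (φ 1 ≈ 0#)) (λ φ1 →
    verticalHalf (riordan g f) ≋ₘ (riordan (comp g φ) X ×ₘ riordan (xφ'/φ φ φ1) φ))
mainTheorem1 F g f _ f₀≈0 f₁≉0 φ (φ₀≈0 , h∘φ≋X) =
  φ₁≉0 ψ w ψ⋆w≋𝟙 φ φ₀≈0 h∘φ≋X ,
  verticalHalf-factorisation ψ w ψ⋆w≋𝟙 φ φ₀≈0 h∘φ≋X _ (xφ'/φ⋆divX φ _) g (X⋆-divX f₀≈0)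
  where
  open FieldOps F
  open SeriesRing commRing
  open Inverse commRing
  open LagrangeInversion F
  ψ w : FPS
  ψ = divX f
  w = invS ψ (proj₁ (inv (f 1) f₁≉0))
  ψ⋆w≋𝟙 : (ψ ⋆ w) ≋ 𝟙
  ψ⋆w≋𝟙 = invS-inverse ψ _ (proj₂ (inv (f 1) f₁≉0))
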